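{- Let $\mathcal B$ be a tight bramble of a graph $G$ and let $S_1,S_2$ be two covers of $\mathcal B$. If $S\subsetneq V(G)$ separates $S_1$ from $S_2$ in $G$, then $S$ is a cover of $\mathcal B$.
   Context: Graphs are finite and simple. Two sets $S_1,S_2\subseteq V(G)$ are touching if $S_1\cap S_2\ne\emptyset$ or there are two distinct edges $x_1x_2,y_1y_2\in E(G)$ with $x_1,y_1\in S_1$, $x_2,y_2\in S_2$. A tight bramble of $G$ is a set $\mathcal B$ of pairwise touching subsets of $V(G)$, each inducing a connected subgraph and of size at least two. A cover of $\mathcal B$ is a set of vertices meeting every element of $\mathcal B$. A set $S$ separates $X\subseteq V(G)$ from $Y\subseteq V(G)$ if $X$ and $Y$ are subsets of distinct connected components of $G-S$. -}

module Defs where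

open import Data.Nat using (ℕ; _≥_)
open import Data.Fin using (Fin)
open import Data.Fin.Subset using (Subset; _∈_; _∉_; ∣_∣)
open import Data.Product using (Σ; ∃; _×_; _,_)
open import Data.Sum using (_⊎_)
open import Data.Empty using (⊥)
open import Relation.Nullary using (¬_)
open import Relation.Binary.PropositionalEquality using (_≡_)
open import Level using (0ℓ)

record Graph (n : ℕ) : Set₁ where
  field
    E       : Fin n → Fin n → Set
    sym     : ∀ {x y} → E x y → E y x
    irrefl  : ∀ {x} → ¬ E x x

module _ {n : ℕ} (G : Graph n) where
  open Graph G

  data WalkIn (P : Fin n → Set) : Fin n → Fin n → Set where
    here : ∀ {x} → P x → WalkIn P x x
    step : ∀ {x y z} → P x → E x y → WalkIn P y z → WalkIn P x z

  -- X induces a connected subgraph of G (empty set counts as connected).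
  Connected : Subset n → Set
  Connected X = ∀ x y → x ∈ X → y ∈ X → WalkIn (λ v → v ∈ X) x y

  DistinctEdges : Fin n → Fin n → Fin n → Fin n → Set
  DistinctEdges x1 x2 y1 y2 =
    ¬ ((x1 ≡ y1 × x2 ≡ y2) ⊎ (x1 ≡ y2 × x2 ≡ y1))

  Touching : Subset n → Subset n → Set
  Touching S₁ S₂ =
    (∃ λ v → v ∈ S₁ × v ∈ S₂)
    ⊎ (∃ λ x1 → ∃ λ x2 → ∃ λ y1 → ∃ λ y2 →
         E x1 x2 × E y1 y2 × DistinctEdges x1 x2 y1 y2
         × x1 ∈ S₁ × y1 ∈ S₁ × x2 ∈ S₂ × y2 ∈ S₂)

  record TightBramble (𝓑 : Subset n → Set) : Set where
    field
      connected : ∀ B → 𝓑 B → Connected B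
      size≥2    : ∀ B → 𝓑 B → ∣ B ∣ ≥ 2
      touching  : ∀ B B′ → 𝓑 B → 𝓑 B′ → Touching B B′

  Cover : (Subset n → Set) → Subset n → Set
  Cover 𝓑 S = ∀ B → 𝓑 B → ∃ λ v → v ∈ B × v ∈ S

  ConnIn : Subset n → Fin n → Fin n → Set
  ConnIn S = WalkIn (λ v → v ∉ S)

  Separates : Subset n → Subset n → Subset n → Set
  Separates S X Y =
    (∀ x → x ∈ X → x ∉ S) × (∀ y → y ∈ Y → y ∉ S)
    × (∀ x x′ → x ∈ X → x′ ∈ X → ConnIn S x x′)
    × (∀ y y′ → y ∈ Y → y′ ∈ Y → ConnIn S y y′)
    × (∀ x y → x ∈ X → y ∈ Y → ¬ ConnIn S x y)

  ProperSubset : Subset n → Set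
  ProperSubset S = ∃ λ v → v ∉ S

-- A bramble element B that avoided S would be connected in G - S, yet it
-- meets both S₁ and S₂, which lie in different components of G - S.

module Submission where

open import Defs
open import Data.Nat using (ℕ)
open import Data.Fin using (Fin)
open import Data.Fin.Subset using (Subset; _∈_; _∉_)
open import Data.Fin.Subset.Properties using (_∈?_)
open import Data.Fin.Properties using (any?)
open import Data.Product using (∃; _×_; _,_)
open import Data.Empty using (⊥-elim)
open import Relation.Nullary using (¬_; Dec; yes; no)
open import Relation.Nullary.Decidable using (_×-dec_)

module _ {n : ℕ} (G : Graph n) where

  WalkIn-mono : ∀ {P Q : Fin n → Set} → (∀ {v} → P v → Q v) →
    ∀ {x y} → WalkIn G P x y → WalkIn G Q x y
  WalkIn-mono P⊆Q (here p)     = here (P⊆Q p)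
  WalkIn-mono P⊆Q (step p e w) = step (P⊆Q p) e (WalkIn-mono P⊆Q w)

  Meets : Subset n → Subset n → Set
  Meets X S = ∃ λ v → v ∈ X × v ∈ S

  meets? : ∀ X S → Dec (Meets X S)
  meets? X S = any? λ v → (v ∈? X) ×-dec (v ∈? S)

  connected-avoiding⇒ConnIn : ∀ {X S} → Connected G X → ¬ Meets X S →
    ∀ {x y} → x ∈ X → y ∈ X → ConnIn G S x y
  connected-avoiding⇒ConnIn conn X∩S=∅ x∈X y∈X =
    WalkIn-mono (λ v∈X v∈S → X∩S=∅ (_ , v∈X , v∈S)) (conn _ _ x∈X y∈X)

  connected-meeting-both-sides⇒meets-separator : ∀ {X S S₁ S₂} →
    Separates G S S₁ S₂ → Connected G X → Meets X S₁ → Meets X S₂ → Meets X S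
  connected-meeting-both-sides⇒meets-separator {X} {S}
      (_ , _ , _ , _ , apart) conn (v₁ , v₁∈X , v₁∈S₁) (v₂ , v₂∈X , v₂∈S₂)
    with meets? X S
  ... | yes X∩S = X∩S
  ... | no X∩S=∅ =
    ⊥-elim (apart v₁ v₂ v₁∈S₁ v₂∈S₂
      (connected-avoiding⇒ConnIn conn X∩S=∅ v₁∈X v₂∈X))

lemma9 : (n : ℕ) (G : Graph n) (𝓑 : Subset n → Set) (S₁ S₂ S : Subset n) →
    TightBramble G 𝓑 → Cover G 𝓑 S₁ → Cover G 𝓑 S₂ →
    ProperSubset G S → Separates G S S₁ S₂ → Cover G 𝓑 S
lemma9 n G 𝓑 S₁ S₂ S tb cover₁ cover₂ _ sep B B∈𝓑 =
  connected-meeting-both-sides⇒meets-separator G sep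
    (TightBramble.connected tb B B∈𝓑) (cover₁ B B∈𝓑) (cover₂ B B∈𝓑)
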